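{- For $n\ge1$, the number $\sigma(n)$ of computationally inequivalent pairwise summations on $n$ distinct variables is $\sigma(n)=\frac{n!}{2^{\varepsilon(n)}}$, where $$\varepsilon(n)=\sum_{i=0}^{\lfloor\log_2 n\rfloor}\left[\left(\left(\left\lfloor\frac{n}{2^i}\right\rfloor+1\right)\bmod 2\right)\cdot 2^i+(-1)^{\left(\left\lfloor\frac{n}{2^i}\right\rfloor+1\right)\bmod 2}\cdot\left(n\bmod 2^i\right)\right].$$
   Context: A summation tree is a rooted full binary tree (every node has $0$ or $2$ children). A summation on $n$ distinct variables is a summation tree with $n$ leaves with a bijective labelling of its leaves by the variables, representing the fully parenthesized sum in which each internal node is the sum of its two children. Two summations are computationally equivalent if one can be obtained from the other by a finite sequence of operations each swapping the two children (with their labelled subtrees) of some internal node. A pairwise-summation tree is a summation tree in which every internal node having $k$ descendant leaves has two children having $\lfloor k/2\rfloor$ and $\lceil k/2\rceil$ descendant leaves respectively; a pairwise summation is a summation whose underlying tree is a pairwise-summation tree. -}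

module Defs where

open import Data.Nat using (ℕ; zero; suc; _+_; _*_; _^_; ⌊_/2⌋; ⌈_/2⌉; NonZero)
open import Data.Nat.DivMod using (_/_; _%_)
open import Data.Nat.Properties using (m^n≢0)
open import Data.Nat.Logarithm using (⌊log₂_⌋)
open import Data.Integer as ℤ using (ℤ; +_; -[1+_])
open import Data.Fin using (Fin)
open import Data.List using (List; []; _∷_; _++_; map; foldr; upTo; allFin; length)
open import Data.List.Relation.Binary.Permutation.Propositional using (_↭_)
open import Data.List.Relation.Unary.AllPairs using (AllPairs)
open import Data.List.Relation.Unary.Any using (Any)
open import Data.Product using (Σ; _×_; proj₁)
open import Data.Sum using (_⊎_)
open import Data.Unit using (⊤)
open import Relation.Binary.PropositionalEquality using (_≡_)
open import Relation.Binary.Construct.Closure.ReflexiveTransitive using (Star)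
open import Relation.Nullary using (¬_)

data Tree (A : Set) : Set where
  leaf : A → Tree A
  node : Tree A → Tree A → Tree A

leaves : {A : Set} → Tree A → List A
leaves (leaf a)   = a ∷ []
leaves (node l r) = leaves l ++ leaves r

size : {A : Set} → Tree A → ℕ
size (leaf _)   = 1
size (node l r) = size l + size r

IsPairwise : {A : Set} → Tree A → Set
IsPairwise (leaf _)   = ⊤
IsPairwise (node l r) =
  IsPairwise l × IsPairwise r ×
  ((size l ≡ ⌊ size l + size r /2⌋ × size r ≡ ⌈ size l + size r /2⌉)
   ⊎ (size l ≡ ⌈ size l + size r /2⌉ × size r ≡ ⌊ size l + size r /2⌋))

IsSummation : (n : ℕ) → Tree (Fin n) → Set
IsSummation n t = leaves t ↭ allFin n

PairwiseSummation : ℕ → Set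
PairwiseSummation n = Σ (Tree (Fin n)) (λ t → IsSummation n t × IsPairwise t)

data SwapStep {A : Set} : Tree A → Tree A → Set where
  here  : ∀ l r → SwapStep (node l r) (node r l)
  left  : ∀ {l l′} r → SwapStep l l′ → SwapStep (node l r) (node l′ r)
  right : ∀ l {r r′} → SwapStep r r′ → SwapStep (node l r) (node l r′)

-- computational equivalence: finite sequence of swaps
_≈ₜ_ : {A : Set} → Tree A → Tree A → Set
_≈ₜ_ = Star SwapStep

IsClassRepresentatives : (n : ℕ) → List (PairwiseSummation n) → Set
IsClassRepresentatives n xs =
  AllPairs (λ a b → ¬ (proj₁ a ≈ₜ proj₁ b)) xs ×
  ((s : PairwiseSummation n) → Any (λ a → proj₁ s ≈ₜ proj₁ a) xs)

sumℤ : List ℤ → ℤ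
sumℤ = foldr ℤ._+_ (+ 0)

pow2 : ℕ → ℕ
pow2 i = 2 ^ i

_mod2^_ : ℕ → ℕ → ℕ
n mod2^ i = _%_ n (2 ^ i) {{m^n≢0 2 i}}

_div2^_ : ℕ → ℕ → ℕ
n div2^ i = _/_ n (2 ^ i) {{m^n≢0 2 i}}

bit : ℕ → ℕ → ℕ
bit n i = (n div2^ i + 1) % 2

ε : ℕ → ℤ
ε n = sumℤ (map term (upTo (suc ⌊log₂ n ⌋)))
  where
  term : ℕ → ℤ
  term i = (+ (bit n i * 2 ^ i)) ℤ.+ ((-[1+ 0 ] ℤ.^ bit n i) ℤ.* (+ (n mod2^ i)))

-- "σ = n! / 2^ε" for an integer exponent ε
IsNFactOver2^ : ℕ → ℕ → ℤ → Set
IsNFactOver2^ σ f (+ e)     = σ * 2 ^ e ≡ f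
IsNFactOver2^ σ f -[1+ e ]  = σ ≡ f * 2 ^ suc e

-- Up to swapping children, a summation tree is determined by the unordered pair of leaf sets
-- of the two children of its root together with the classes of those children.  In a
-- pairwise-summation tree a node with k leaves splits them into ⌊k/2⌋ and ⌈k/2⌉; for odd k the
-- split can be oriented by size, for even k by putting a fixed label into the left child.  So
-- the classes on n labels are obtained by choosing such a split at every internal node, halved
-- at even nodes, and there are n!/2^E(n) of them, E(n) being the number of internal nodes with an
-- even number of leaves.  The subtrees at depth i have q = ⌊n/2^i⌋ or q + 1 leaves, r = n mod 2^i
-- of them q + 1; the i-th summand of ε(n) is the number of even ones among them (2^i − r when q
-- is even, r when q is odd), hence ε(n) = E(n).
module Submission where

open import Defs
open import Data.Nat using (ℕ; _≤_; _!)
open import Data.List using (length)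
open import Data.Product using (∃-syntax; _×_)

open import Function using (_∘_)
open import Data.Product using (_,_; proj₁; proj₂; ∃; ∃₂; map₁; map₂)
open import Data.Product.Relation.Binary.Pointwise.NonDependent using (Pointwise)
open import Data.Sum using (_⊎_; inj₁; inj₂; [_,_]′)
open import Relation.Nullary using (¬_; contradiction)
open import Relation.Binary.Definitions using (_Respects_)
open import Relation.Binary.PropositionalEquality
open import Relation.Binary.Construct.Closure.ReflexiveTransitive
  using (_◅_; _◅◅_; gmap; fold) renaming (ε to ε⋆)
open import Data.Nat using (zero; suc; _+_; _*_; _^_; _∸_; _<_; z≤n; s≤s; ⌊_/2⌋; ⌈_/2⌉; NonZero)
open import Data.Nat.Properties
open import Data.Nat.DivMod
  using ( _/_; _%_; m≡m%n+[m/n]*n; m%n<n; n%1≡0; n/1≡n; +-distrib-/-∣ʳ; m<n⇒m/n≡0; m*n/n≡m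
        ; [m+kn]%n≡m%n; m<n⇒m%n≡m; m/n*n≡m)
open import Data.Nat.Divisibility using (divides-refl)
open import Data.Nat.Logarithm using (⌊log₂_⌋; ⌊log₂⌊n/2⌋⌋≡⌊log₂n⌋∸1; ⌊log₂⌋-mono-≤)
open import Data.Nat.Combinatorics
  using (_C_; nCk≡n!/k![n-k]!; nCk≡nC[n∸k]; nCk+nC[k+1]≡[n+1]C[k+1]; k![n∸k]!∣n!)
open import Data.Nat.Tactic.RingSolver using (solve-∀)
open import Data.Integer as ℤ using (ℤ; +_; -[1+_]; 1ℤ)
import Data.Integer.Properties as ℤ
import Data.Integer.Tactic.RingSolver as ℤ-Solver
open import Data.List using (List; []; _∷_; _++_; allFin; map; applyUpTo; concatMap; cartesianProductWith)
open import Data.List.Properties using (map-upTo; length-++; length-map; length-tabulate)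
open import Data.List.Relation.Unary.All as All using (All; []; _∷_)
import Data.List.Relation.Unary.All.Properties as All
open import Data.List.Relation.Unary.Any as Any using (Any; here; there)
import Data.List.Relation.Unary.Any.Properties as Any
open import Data.List.Relation.Unary.AllPairs as AllPairs using (AllPairs; []; _∷_)
import Data.List.Relation.Unary.AllPairs.Properties as AllPairs
open import Data.List.Relation.Unary.Unique.Propositional using (Unique)
open import Data.List.Relation.Unary.Unique.Propositional.Properties using (Unique[x∷xs]⇒x∉xs; allFin⁺)
open import Data.List.Membership.Propositional using (_∈_)
open import Data.List.Membership.Propositional.Properties using (∈-++⁻; ∈-++⁺ˡ; ∈-++⁺ʳ; ∈-∃++)
open import Data.List.Relation.Binary.Permutation.Propositional
  using (_↭_; ↭-refl; ↭-sym; ↭-trans; prep; ↭⇒↭ₛ)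
open import Data.List.Relation.Binary.Permutation.Propositional.Properties
  using (++-comm; ++⁺; ++⁺ˡ; ++⁺ʳ; shift; drop-∷; ↭-length; ∈-resp-↭; ↭-singleton-inv; ↭-empty-inv)
import Data.List.Relation.Binary.Permutation.Setoid.Properties as Permutationₛ
open ≡-Reasoning

data Parity (k : ℕ) : Set where
  even : ∀ p → k ≡ p * 2 → Parity k
  odd  : ∀ p → k ≡ suc (p * 2) → Parity k

parity : ∀ k → Parity k
parity zero = even 0 refl
parity (suc k) with parity k
... | even p refl = odd p refl
... | odd p refl  = even (suc p) refl

⌊n*2/2⌋≡n : ∀ n → ⌊ n * 2 /2⌋ ≡ n
⌊n*2/2⌋≡n zero    = refl
⌊n*2/2⌋≡n (suc n) = cong suc (⌊n*2/2⌋≡n n)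

⌈n*2/2⌉≡n : ∀ n → ⌈ n * 2 /2⌉ ≡ n
⌈n*2/2⌉≡n zero    = refl
⌈n*2/2⌉≡n (suc n) = cong suc (⌈n*2/2⌉≡n n)

⌊[2+n]/2⌋≤1+n : ∀ n → ⌊ suc (suc n) /2⌋ ≤ suc n
⌊[2+n]/2⌋≤1+n n = ≤-pred (⌊n/2⌋<n (suc n))

⌈[2+n]/2⌉≤1+n : ∀ n → ⌈ suc (suc n) /2⌉ ≤ suc n
⌈[2+n]/2⌉≤1+n n = ≤-pred (⌈n/2⌉<n n)

⌈n/2⌉≡n∸⌊n/2⌋ : ∀ n → ⌈ n /2⌉ ≡ n ∸ ⌊ n /2⌋
⌈n/2⌉≡n∸⌊n/2⌋ n =
  trans (sym (m+n∸m≡n ⌊ n /2⌋ ⌈ n /2⌉)) (cong (_∸ ⌊ n /2⌋) (⌊n/2⌋+⌈n/2⌉≡n n))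

halves[1+p*2] : ∀ {m} p → m ≡ p * 2 → ⌊ suc m /2⌋ ≡ p × ⌈ suc m /2⌉ ≡ suc p
halves[1+p*2] p refl = ⌈n*2/2⌉≡n p , cong suc (⌊n*2/2⌋≡n p)

halves[2+p*2] : ∀ {m} p → m ≡ suc (p * 2) → ⌊ suc m /2⌋ ≡ suc p × ⌈ suc m /2⌉ ≡ suc p
halves[2+p*2] p refl = cong suc (⌊n*2/2⌋≡n p) , cong suc (⌈n*2/2⌉≡n p)

Balanced : ℕ → ℕ → Set
Balanced m n = (m ≡ ⌊ m + n /2⌋ × n ≡ ⌈ m + n /2⌉) ⊎ (m ≡ ⌈ m + n /2⌉ × n ≡ ⌊ m + n /2⌋)

balanced-halves : ∀ k → Balanced ⌊ k /2⌋ ⌈ k /2⌉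
balanced-halves k rewrite ⌊n/2⌋+⌈n/2⌉≡n k = inj₁ (refl , refl)

Balanced⇒halves : ∀ {m n k} → m + n ≡ k → Balanced m n →
                  (m ≡ ⌊ k /2⌋ × n ≡ ⌈ k /2⌉) ⊎ (m ≡ ⌈ k /2⌉ × n ≡ ⌊ k /2⌋)
Balanced⇒halves refl balanced = balanced

nCk*[k!*[n∸k]!]≡n! : ∀ {n k} → k ≤ n → (n C k) * (k ! * (n ∸ k) !) ≡ n !
nCk*[k!*[n∸k]!]≡n! {n} {k} k≤n = begin
  (n C k) * (k ! * (n ∸ k) !)                   ≡⟨ cong (_* (k ! * (n ∸ k) !)) (nCk≡n!/k![n-k]! k≤n) ⟩
  n ! / (k ! * (n ∸ k) !) * (k ! * (n ∸ k) !) ≡⟨ m/n*n≡m (k![n∸k]!∣n! k≤n) ⟩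
  n !                                         ∎
  where instance _ = k !* (n ∸ k) !≢0

n*2≡n+n : ∀ n → n * 2 ≡ n + n
n*2≡n+n = solve-∀

[1+n*2]Cn*2≡[2+n*2]C[1+n] : ∀ n → (suc (n * 2) C n) * 2 ≡ suc (suc (n * 2)) C suc n
[1+n*2]Cn*2≡[2+n*2]C[1+n] n = begin
  (m C n) * 2             ≡⟨ *-comm (m C n) 2 ⟩
  m C n + (m C n + 0)     ≡⟨ cong (λ y → m C n + y) (+-identityʳ (m C n)) ⟩
  m C n + m C n           ≡⟨ cong (λ y → m C n + y) symmetric ⟨
  m C n + m C suc n       ≡⟨ nCk+nC[k+1]≡[n+1]C[k+1] m n ⟩
  suc m C suc n           ∎
  where
  m = suc (n * 2)
  n*2∸n≡n : n * 2 ∸ n ≡ n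
  n*2∸n≡n = trans (cong (_∸ n) (n*2≡n+n n)) (m+n∸m≡n n n)
  symmetric : m C suc n ≡ m C n
  symmetric = trans (nCk≡nC[n∸k] (s≤s (≤-trans (m≤m+n n n) (≤-reflexive (sym (n*2≡n+n n))))))
                    (cong (m C_) n*2∸n≡n)

-- Even internal nodes of a pairwise-summation tree

-- bit n i is evenIndicator (n div2^ i) by definition.
evenIndicator : ℕ → ℕ
evenIndicator k = (k + 1) % 2

evenIndicator[n*2]≡1 : ∀ n → evenIndicator (n * 2) ≡ 1
evenIndicator[n*2]≡1 zero    = refl
evenIndicator[n*2]≡1 (suc n) = evenIndicator[n*2]≡1 n

evenIndicator[1+n*2]≡0 : ∀ n → evenIndicator (suc (n * 2)) ≡ 0
evenIndicator[1+n*2]≡0 zero    = refl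
evenIndicator[1+n*2]≡0 (suc n) = evenIndicator[1+n*2]≡0 n

-- evenNodes′ fuel k counts the internal nodes with an even number of leaves in a
-- pairwise-summation tree with k leaves, provided fuel ≥ k.
evenNodes′ : ℕ → ℕ → ℕ
evenNodes′ _          zero             = 0
evenNodes′ _          (suc zero)       = 0
evenNodes′ zero       (suc (suc _))    = 0
evenNodes′ (suc fuel) k@(suc (suc _))  =
  evenIndicator k + evenNodes′ fuel ⌊ k /2⌋ + evenNodes′ fuel ⌈ k /2⌉

evenNodes : ℕ → ℕ
evenNodes k = evenNodes′ k k

evenNodes′-fuel : ∀ {f g} k → k ≤ f → k ≤ g → evenNodes′ f k ≡ evenNodes′ g k
evenNodes′-fuel zero          _         _         = refl
evenNodes′-fuel (suc zero)    _         _         = refl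
evenNodes′-fuel (suc (suc m)) (s≤s k≤f) (s≤s k≤g) = cong₂ (λ a b → evenIndicator (suc (suc m)) + a + b)
  (evenNodes′-fuel _ (≤-trans (⌊[2+n]/2⌋≤1+n m) k≤f) (≤-trans (⌊[2+n]/2⌋≤1+n m) k≤g))
  (evenNodes′-fuel _ (≤-trans (⌈[2+n]/2⌉≤1+n m) k≤f) (≤-trans (⌈[2+n]/2⌉≤1+n m) k≤g))

evenNodes-unfold : ∀ m → let k = suc (suc m) in
  evenNodes k ≡ evenIndicator k + evenNodes ⌊ k /2⌋ + evenNodes ⌈ k /2⌉
evenNodes-unfold m = cong₂ (λ a b → evenIndicator (suc (suc m)) + a + b)
  (evenNodes′-fuel _ (⌊[2+n]/2⌋≤1+n m) ≤-refl)
  (evenNodes′-fuel _ (⌈[2+n]/2⌉≤1+n m) ≤-refl)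

2^evenNodes-unfold : ∀ m → let k = suc (suc m) in
  2 ^ evenNodes k ≡ 2 ^ evenIndicator k * (2 ^ evenNodes ⌊ k /2⌋ * 2 ^ evenNodes ⌈ k /2⌉)
2^evenNodes-unfold m = begin
  2 ^ evenNodes k                               ≡⟨ cong (2 ^_) (evenNodes-unfold m) ⟩
  2 ^ (δ + a + b)                               ≡⟨ ^-distribˡ-+-* 2 (δ + a) b ⟩
  2 ^ (δ + a) * 2 ^ b                           ≡⟨ cong (_* 2 ^ b) (^-distribˡ-+-* 2 δ a) ⟩
  2 ^ δ * 2 ^ a * 2 ^ b                         ≡⟨ *-assoc (2 ^ δ) (2 ^ a) (2 ^ b) ⟩
  2 ^ δ * (2 ^ a * 2 ^ b)                       ∎
  where
  k = suc (suc m)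
  δ = evenIndicator k
  a = evenNodes ⌊ k /2⌋
  b = evenNodes ⌈ k /2⌉

evenNodes[2+n*2] : ∀ n → evenNodes (suc n * 2) ≡ 1 + evenNodes (suc n) + evenNodes (suc n)
evenNodes[2+n*2] n = begin
  evenNodes (suc n * 2)                                                   ≡⟨ evenNodes-unfold (n * 2) ⟩
  evenIndicator (suc n * 2) + evenNodes ⌊ suc n * 2 /2⌋ + evenNodes ⌈ suc n * 2 /2⌉
    ≡⟨ cong₂ _+_ (cong₂ _+_ (evenIndicator[n*2]≡1 (suc n)) (cong evenNodes (⌊n*2/2⌋≡n (suc n))))
                 (cong evenNodes (⌈n*2/2⌉≡n (suc n))) ⟩
  1 + evenNodes (suc n) + evenNodes (suc n)                               ∎

evenNodes[1+n*2] : ∀ n → evenNodes (suc (n * 2)) ≡ evenNodes n + evenNodes (suc n)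
evenNodes[1+n*2] zero    = refl
evenNodes[1+n*2] (suc n) = begin
  evenNodes (suc (suc n * 2))                                             ≡⟨ evenNodes-unfold (suc (n * 2)) ⟩
  evenIndicator (suc (suc n * 2)) + evenNodes (suc ⌈ n * 2 /2⌉) + evenNodes (suc (suc ⌊ n * 2 /2⌋))
    ≡⟨ cong₂ _+_ (cong₂ _+_ (evenIndicator[1+n*2]≡0 (suc n)) (cong (evenNodes ∘ suc) (⌈n*2/2⌉≡n n)))
                 (cong (evenNodes ∘ suc ∘ suc) (⌊n*2/2⌋≡n n)) ⟩
  evenNodes (suc n) + evenNodes (suc (suc n))                             ∎

+evenNodes[2+n*2] : ∀ n → + evenNodes (suc n * 2) ≡ 1ℤ ℤ.+ + evenNodes (suc n) ℤ.+ + evenNodes (suc n)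
+evenNodes[2+n*2] n = begin
  + evenNodes (suc n * 2)                           ≡⟨ cong +_ (evenNodes[2+n*2] n) ⟩
  + (1 + evenNodes (suc n) + evenNodes (suc n))     ≡⟨ ℤ.pos-+ (1 + evenNodes (suc n)) (evenNodes (suc n)) ⟩
  + (1 + evenNodes (suc n)) ℤ.+ + evenNodes (suc n)
    ≡⟨ cong (ℤ._+ + evenNodes (suc n)) (ℤ.pos-+ 1 (evenNodes (suc n))) ⟩
  1ℤ ℤ.+ + evenNodes (suc n) ℤ.+ + evenNodes (suc n) ∎

+evenNodes[1+n*2] : ∀ n → + evenNodes (suc (n * 2)) ≡ + evenNodes n ℤ.+ + evenNodes (suc n)
+evenNodes[1+n*2] n = trans (cong +_ (evenNodes[1+n*2] n)) (ℤ.pos-+ (evenNodes n) (evenNodes (suc n)))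

divMod-unique : ∀ {m d} .{{_ : NonZero d}} r q → r < d → m ≡ r + q * d → m / d ≡ q × m % d ≡ r
divMod-unique {d = d} r q r<d refl =
  trans (+-distrib-/-∣ʳ r (divides-refl q)) (cong₂ _+_ (m<n⇒m/n≡0 r<d) (m*n/n≡m q d)) ,
  trans ([m+kn]%n≡m%n r q d) (m<n⇒m%n≡m r<d)

div2^-mod2^-suc : ∀ n i {b p} → b ≤ 1 → n div2^ i ≡ b + p * 2 →
                  n div2^ suc i ≡ p × n mod2^ suc i ≡ n mod2^ i + b * 2 ^ i
div2^-mod2^-suc n i {b} {p} b≤1 n/2^i≡b+p*2 = divMod-unique (n % 2 ^ i + b * 2 ^ i) p bound decomposition
  where
  instance
    _ = m^n≢0 2 i
    _ = m^n≢0 2 (suc i)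
  bound : n % 2 ^ i + b * 2 ^ i < 2 ^ suc i
  bound = +-mono-<-≤ (m%n<n n (2 ^ i)) (*-monoˡ-≤ (2 ^ i) b≤1)
  regroup : ∀ r b p x → r + (b + p * 2) * x ≡ r + b * x + p * (2 * x)
  regroup = solve-∀
  decomposition : n ≡ n % 2 ^ i + b * 2 ^ i + p * 2 ^ suc i
  decomposition = begin
    n                               ≡⟨ m≡m%n+[m/n]*n n (2 ^ i) ⟩
    n % 2 ^ i + n / 2 ^ i * 2 ^ i   ≡⟨ cong (λ q → n % 2 ^ i + q * 2 ^ i) n/2^i≡b+p*2 ⟩
    n % 2 ^ i + (b + p * 2) * 2 ^ i ≡⟨ regroup (n % 2 ^ i) b p (2 ^ i) ⟩
    n % 2 ^ i + b * 2 ^ i + p * 2 ^ suc i ∎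

div2^-suc : ∀ n i → n div2^ suc i ≡ ⌊ n div2^ i /2⌋
div2^-suc n i with parity (n div2^ i)
... | even p q≡p*2   = trans (proj₁ (div2^-mod2^-suc n i z≤n q≡p*2))
                             (sym (trans (cong ⌊_/2⌋ q≡p*2) (⌊n*2/2⌋≡n p)))
... | odd p q≡1+p*2  = trans (proj₁ (div2^-mod2^-suc n i (s≤s z≤n) q≡1+p*2))
                             (sym (trans (cong ⌊_/2⌋ q≡1+p*2) (⌈n*2/2⌉≡n p)))

⌊log₂div2^⌋ : ∀ n i → ⌊log₂ (n div2^ i) ⌋ ≡ ⌊log₂ n ⌋ ∸ i
⌊log₂div2^⌋ n zero    = cong ⌊log₂_⌋ (n/1≡n n)
⌊log₂div2^⌋ n (suc i) = begin
  ⌊log₂ (n div2^ suc i) ⌋   ≡⟨ cong ⌊log₂_⌋ (div2^-suc n i) ⟩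
  ⌊log₂ ⌊ n div2^ i /2⌋ ⌋   ≡⟨ ⌊log₂⌊n/2⌋⌋≡⌊log₂n⌋∸1 (n div2^ i) ⟩
  ⌊log₂ (n div2^ i) ⌋ ∸ 1   ≡⟨ cong (_∸ 1) (⌊log₂div2^⌋ n i) ⟩
  ⌊log₂ n ⌋ ∸ i ∸ 1         ≡⟨ ∸-+-assoc ⌊log₂ n ⌋ i 1 ⟩
  ⌊log₂ n ⌋ ∸ (i + 1)       ≡⟨ cong (⌊log₂ n ⌋ ∸_) (+-comm i 1) ⟩
  ⌊log₂ n ⌋ ∸ suc i         ∎

1≤⌊log₂n⌋⇒1≤⌊n/2⌋ : ∀ {n} → 1 ≤ ⌊log₂ n ⌋ → 1 ≤ ⌊ n /2⌋
1≤⌊log₂n⌋⇒1≤⌊n/2⌋ {suc (suc n)} _ = s≤s z≤n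

⌊log₂n⌋≡0⇒⌊n/2⌋≡0 : ∀ {n} → ⌊log₂ n ⌋ ≡ 0 → ⌊ n /2⌋ ≡ 0
⌊log₂n⌋≡0⇒⌊n/2⌋≡0 {zero}        _ = refl
⌊log₂n⌋≡0⇒⌊n/2⌋≡0 {suc zero}    _ = refl
⌊log₂n⌋≡0⇒⌊n/2⌋≡0 {suc (suc n)} ⌊log₂n⌋≡0 =
  contradiction (subst (1 ≤_) ⌊log₂n⌋≡0 (⌊log₂⌋-mono-≤ {2} {suc (suc n)} (s≤s (s≤s z≤n)))) λ ()

1≤div2^ : ∀ n i → 1 ≤ n → i ≤ ⌊log₂ n ⌋ → 1 ≤ n div2^ i
1≤div2^ n zero    1≤n _ = subst (1 ≤_) (sym (n/1≡n n)) 1≤n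
1≤div2^ n (suc i) _   i<⌊log₂n⌋ = subst (1 ≤_) (sym (div2^-suc n i))
  (1≤⌊log₂n⌋⇒1≤⌊n/2⌋ (subst (1 ≤_) (sym (⌊log₂div2^⌋ n i)) (m<n⇒0<n∸m i<⌊log₂n⌋)))

div2^[1+⌊log₂n⌋]≡0 : ∀ n → n div2^ suc ⌊log₂ n ⌋ ≡ 0
div2^[1+⌊log₂n⌋]≡0 n = trans (div2^-suc n ⌊log₂ n ⌋)
  (⌊log₂n⌋≡0⇒⌊n/2⌋≡0 (trans (⌊log₂div2^⌋ n ⌊log₂ n ⌋) (n∸n≡0 ⌊log₂ n ⌋)))

-- ε(n) counts the even internal nodes level by level

-- The number of even internal nodes in a forest of x − r pairwise-summation trees with q
-- leaves and r with q + 1 leaves.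
forestEvenNodes : ℕ → ℕ → ℕ → ℤ
forestEvenNodes x r q = (+ x ℤ.- + r) ℤ.* + evenNodes q ℤ.+ + r ℤ.* + evenNodes (suc q)

forestEvenNodes-empty : ∀ x r → forestEvenNodes x r 0 ≡ + 0
forestEvenNodes-empty x r = cong₂ ℤ._+_ (ℤ.*-zeroʳ (+ x ℤ.- + r)) (ℤ.*-zeroʳ (+ r))

forestEvenNodes-even : ∀ x r p →
  + x ℤ.- + r ℤ.+ forestEvenNodes (x + x) r (suc p) ≡ forestEvenNodes x r (suc p * 2)
forestEvenNodes-even x r p = begin
  X ℤ.- R ℤ.+ ((+ (x + x) ℤ.- R) ℤ.* a ℤ.+ R ℤ.* c)
    ≡⟨ cong (λ y → X ℤ.- R ℤ.+ ((y ℤ.- R) ℤ.* a ℤ.+ R ℤ.* c)) (ℤ.pos-+ x x) ⟩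
  X ℤ.- R ℤ.+ ((X ℤ.+ X ℤ.- R) ℤ.* a ℤ.+ R ℤ.* c)
    ≡⟨ regroup X R a c ⟩
  (X ℤ.- R) ℤ.* (1ℤ ℤ.+ a ℤ.+ a) ℤ.+ R ℤ.* (a ℤ.+ c)
    ≡⟨ cong₂ (λ e e′ → (X ℤ.- R) ℤ.* e ℤ.+ R ℤ.* e′)
             (+evenNodes[2+n*2] p) (+evenNodes[1+n*2] (suc p)) ⟨
  forestEvenNodes x r (suc p * 2) ∎
  where
  X = + x
  R = + r
  a = + evenNodes (suc p)
  c = + evenNodes (suc (suc p))
  regroup : ∀ X R a c → X ℤ.- R ℤ.+ ((X ℤ.+ X ℤ.- R) ℤ.* a ℤ.+ R ℤ.* c) ≡
                        (X ℤ.- R) ℤ.* (1ℤ ℤ.+ a ℤ.+ a) ℤ.+ R ℤ.* (a ℤ.+ c)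
  regroup = ℤ-Solver.solve-∀

forestEvenNodes-odd : ∀ x r p →
  + r ℤ.+ forestEvenNodes (x + x) (r + x) p ≡ forestEvenNodes x r (suc (p * 2))
forestEvenNodes-odd x r p = begin
  R ℤ.+ ((+ (x + x) ℤ.- + (r + x)) ℤ.* a ℤ.+ + (r + x) ℤ.* c)
    ≡⟨ cong₂ (λ y z → R ℤ.+ ((y ℤ.- z) ℤ.* a ℤ.+ z ℤ.* c)) (ℤ.pos-+ x x) (ℤ.pos-+ r x) ⟩
  R ℤ.+ ((X ℤ.+ X ℤ.- (R ℤ.+ X)) ℤ.* a ℤ.+ (R ℤ.+ X) ℤ.* c)
    ≡⟨ regroup X R a c ⟩
  (X ℤ.- R) ℤ.* (a ℤ.+ c) ℤ.+ R ℤ.* (1ℤ ℤ.+ c ℤ.+ c)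
    ≡⟨ cong₂ (λ e e′ → (X ℤ.- R) ℤ.* e ℤ.+ R ℤ.* e′) (+evenNodes[1+n*2] p) (+evenNodes[2+n*2] p) ⟨
  forestEvenNodes x r (suc (p * 2)) ∎
  where
  X = + x
  R = + r
  a = + evenNodes p
  c = + evenNodes (suc p)
  regroup : ∀ X R a c → R ℤ.+ ((X ℤ.+ X ℤ.- (R ℤ.+ X)) ℤ.* a ℤ.+ (R ℤ.+ X) ℤ.* c) ≡
                        (X ℤ.- R) ℤ.* (a ℤ.+ c) ℤ.+ R ℤ.* (1ℤ ℤ.+ c ℤ.+ c)
  regroup = ℤ-Solver.solve-∀

signedTerm : ℕ → ℕ → ℕ → ℤ
signedTerm b x r = + (b * x) ℤ.+ (-[1+ 0 ] ℤ.^ b) ℤ.* + r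

-- The i-th summand of ε n, which unfolds to sumℤ (map (levelTerm n) (upTo (suc ⌊log₂ n ⌋))).
levelTerm : ℕ → ℕ → ℤ
levelTerm n i = signedTerm (bit n i) (2 ^ i) (n mod2^ i)

levelTerm-even : ∀ n i p → n div2^ i ≡ p * 2 → levelTerm n i ≡ + (2 ^ i) ℤ.- + (n mod2^ i)
levelTerm-even n i p q≡p*2 = begin
  signedTerm (bit n i) (2 ^ i) (n mod2^ i) ≡⟨ cong (λ b → signedTerm b (2 ^ i) (n mod2^ i)) bit≡1 ⟩
  signedTerm 1 (2 ^ i) (n mod2^ i)
    ≡⟨ cong₂ ℤ._+_ (cong +_ (+-identityʳ (2 ^ i))) (ℤ.-1*i≡-i (+ (n mod2^ i))) ⟩
  + (2 ^ i) ℤ.- + (n mod2^ i)                ∎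
  where
  bit≡1 : bit n i ≡ 1
  bit≡1 = trans (cong evenIndicator q≡p*2) (evenIndicator[n*2]≡1 p)

levelTerm-odd : ∀ n i p → n div2^ i ≡ suc (p * 2) → levelTerm n i ≡ + (n mod2^ i)
levelTerm-odd n i p q≡1+p*2 = begin
  signedTerm (bit n i) (2 ^ i) (n mod2^ i) ≡⟨ cong (λ b → signedTerm b (2 ^ i) (n mod2^ i)) bit≡0 ⟩
  signedTerm 0 (2 ^ i) (n mod2^ i)         ≡⟨ trans (ℤ.+-identityˡ _) (ℤ.*-identityˡ _) ⟩
  + (n mod2^ i)                            ∎
  where
  bit≡0 : bit n i ≡ 0
  bit≡0 = trans (cong evenIndicator q≡1+p*2) (evenIndicator[1+n*2]≡0 p)

-- The subtrees at depth i of the pairwise-summation tree with n leaves form such a forest.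
evenNodesBelow : ℕ → ℕ → ℤ
evenNodesBelow n i = forestEvenNodes (2 ^ i) (n mod2^ i) (n div2^ i)

evenNodesBelow-suc : ∀ n i {b p} → b ≤ 1 → n div2^ i ≡ b + p * 2 →
  evenNodesBelow n (suc i) ≡ forestEvenNodes (2 ^ i + 2 ^ i) (n mod2^ i + b * 2 ^ i) p
evenNodesBelow-suc n i {b} {p} b≤1 q≡b+p*2 with div2^-mod2^-suc n i {b} {p} b≤1 q≡b+p*2
... | q′≡p , r′≡r+b*2^i = trans (cong₂ (forestEvenNodes (2 ^ suc i)) r′≡r+b*2^i q′≡p)
  (cong (λ x → forestEvenNodes x (n mod2^ i + b * 2 ^ i) p) (cong (λ y → 2 ^ i + y) (+-identityʳ (2 ^ i))))

evenNodesBelow-step : ∀ n i → 1 ≤ n div2^ i → levelTerm n i ℤ.+ evenNodesBelow n (suc i) ≡ evenNodesBelow n i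
evenNodesBelow-step n i 1≤q with parity (n div2^ i)
... | even zero q≡0 = contradiction (subst (1 ≤_) q≡0 1≤q) λ ()
... | even (suc p) q≡2+p*2 = begin
  levelTerm n i ℤ.+ evenNodesBelow n (suc i)
    ≡⟨ cong₂ ℤ._+_ (levelTerm-even n i (suc p) q≡2+p*2)
                   (trans (evenNodesBelow-suc n i {0} {suc p} z≤n q≡2+p*2)
                          (cong (λ r′ → forestEvenNodes (2 ^ i + 2 ^ i) r′ (suc p)) (+-identityʳ r))) ⟩
  + (2 ^ i) ℤ.- + r ℤ.+ forestEvenNodes (2 ^ i + 2 ^ i) r (suc p)  ≡⟨ forestEvenNodes-even (2 ^ i) r p ⟩
  forestEvenNodes (2 ^ i) r (suc p * 2)                          ≡⟨ cong (forestEvenNodes (2 ^ i) r) q≡2+p*2 ⟨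
  evenNodesBelow n i                                             ∎
  where r = n mod2^ i
... | odd p q≡1+p*2 = begin
  levelTerm n i ℤ.+ evenNodesBelow n (suc i)
    ≡⟨ cong₂ ℤ._+_ (levelTerm-odd n i p q≡1+p*2)
                   (trans (evenNodesBelow-suc n i {1} {p} (s≤s z≤n) q≡1+p*2)
                          (cong (λ x → forestEvenNodes (2 ^ i + 2 ^ i) (r + x) p) (*-identityˡ (2 ^ i)))) ⟩
  + r ℤ.+ forestEvenNodes (2 ^ i + 2 ^ i) (r + 2 ^ i) p          ≡⟨ forestEvenNodes-odd (2 ^ i) r p ⟩
  forestEvenNodes (2 ^ i) r (suc (p * 2))                        ≡⟨ cong (forestEvenNodes (2 ^ i) r) q≡1+p*2 ⟨
  evenNodesBelow n i                                             ∎
  where r = n mod2^ i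

telescope : ∀ (f g : ℕ → ℤ) m → (∀ i → i < m → f i ℤ.+ g (suc i) ≡ g i) →
            sumℤ (applyUpTo f m) ℤ.+ g m ≡ g 0
telescope f g zero    _    = ℤ.+-identityˡ (g 0)
telescope f g (suc m) step = begin
  f 0 ℤ.+ sumℤ (applyUpTo (f ∘ suc) m) ℤ.+ g (suc m)   ≡⟨ ℤ.+-assoc (f 0) _ _ ⟩
  f 0 ℤ.+ (sumℤ (applyUpTo (f ∘ suc) m) ℤ.+ g (suc m)) ≡⟨ cong (λ y → f 0 ℤ.+ y) shifted ⟩
  f 0 ℤ.+ g 1                                          ≡⟨ step 0 (s≤s z≤n) ⟩
  g 0                                                  ∎
  where
  shifted = telescope (f ∘ suc) (g ∘ suc) m (λ i i<m → step (suc i) (s≤s i<m))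

ε≡+evenNodes : ∀ n → 1 ≤ n → ε n ≡ + evenNodes n
ε≡+evenNodes n 1≤n = begin
  ε n                                                          ≡⟨ cong sumℤ (map-upTo (levelTerm n) (suc L)) ⟩
  sumℤ (applyUpTo (levelTerm n) (suc L))                       ≡⟨ ℤ.+-identityʳ _ ⟨
  sumℤ (applyUpTo (levelTerm n) (suc L)) ℤ.+ + 0
    ≡⟨ cong (λ y → sumℤ (applyUpTo (levelTerm n) (suc L)) ℤ.+ y) beyond ⟨
  sumℤ (applyUpTo (levelTerm n) (suc L)) ℤ.+ evenNodesBelow n (suc L)
    ≡⟨ telescope (levelTerm n) (evenNodesBelow n) (suc L)
                 (λ i i≤L → evenNodesBelow-step n i (1≤div2^ n i 1≤n (≤-pred i≤L))) ⟩
  evenNodesBelow n 0                                           ≡⟨ cong₂ (forestEvenNodes 1) (n%1≡0 n) (n/1≡n n) ⟩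
  forestEvenNodes 1 0 n                                        ≡⟨ trans (ℤ.+-identityʳ _) (ℤ.*-identityˡ _) ⟩
  + evenNodes n                                                ∎
  where
  L = ⌊log₂ n ⌋
  beyond : evenNodesBelow n (suc L) ≡ + 0
  beyond = trans (cong (forestEvenNodes (2 ^ suc L) (n mod2^ suc L)) (div2^[1+⌊log₂n⌋]≡0 n))
                 (forestEvenNodes-empty (2 ^ suc L) (n mod2^ suc L))

length-cartesianProductWith : {B C D : Set} (f : B → C → D) (xs : List B) (ys : List C) →
                              length (cartesianProductWith f xs ys) ≡ length xs * length ys
length-cartesianProductWith f []       ys = refl
length-cartesianProductWith f (x ∷ xs) ys = trans (length-++ (map (f x) ys))
  (cong₂ _+_ (length-map (f x) ys) (length-cartesianProductWith f xs ys))

length-concatMap-uniform : {B C : Set} (f : B → List C) {xs : List B} {m c : ℕ} →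
                           All (λ x → length (f x) * m ≡ c) xs → length (concatMap f xs) * m ≡ length xs * c
length-concatMap-uniform f         []                 = refl
length-concatMap-uniform f {x ∷ xs} {m} {c} (|fx|*m≡c ∷ rest) = begin
  length (f x ++ concatMap f xs) * m             ≡⟨ cong (_* m) (length-++ (f x)) ⟩
  (length (f x) + length (concatMap f xs)) * m   ≡⟨ *-distribʳ-+ m (length (f x)) _ ⟩
  length (f x) * m + length (concatMap f xs) * m ≡⟨ cong₂ _+_ |fx|*m≡c (length-concatMap-uniform f rest) ⟩
  c + length xs * c                              ∎

map-proj₁-toList : {B : Set} {P : B → Set} {xs : List B} (pxs : All P xs) → map proj₁ (All.toList pxs) ≡ xs
map-proj₁-toList []         = refl
map-proj₁-toList (px ∷ pxs) = cong (_ ∷_) (map-proj₁-toList pxs)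

AllPairs-mapWith : {B : Set} {P : B → Set} {R S : B → B → Set} {xs : List B} → All P xs →
                   (∀ {x y} → P x → P y → R x y → S x y) → AllPairs R xs → AllPairs S xs
AllPairs-mapWith []         _ []          = []
AllPairs-mapWith (px ∷ pxs) f (Rx ∷ Rxs) =
  All.zipWith (λ (py , r) → f px py r) (pxs , Rx) ∷ AllPairs-mapWith pxs f Rxs

module _ {A : Set} where

  ∈⇒↭∷ : {x : A} {xs : List A} → x ∈ xs → ∃ λ ys → xs ↭ x ∷ ys
  ∈⇒↭∷ {x} x∈xs with ∈-∃++ x∈xs
  ... | ys , zs , refl = ys ++ zs , shift x ys zs

  ↭-transport : {xs xs′ ys ys′ : List A} → xs ↭ xs′ → ys ↭ ys′ → xs ↭ ys → xs′ ↭ ys′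
  ↭-transport xs↭xs′ ys↭ys′ xs↭ys = ↭-trans (↭-sym xs↭xs′) (↭-trans xs↭ys ys↭ys′)

  Unique-resp-↭ : {xs ys : List A} → xs ↭ ys → Unique xs → Unique ys
  Unique-resp-↭ xs↭ys = Permutationₛ.Unique-resp-↭ (setoid A) (↭⇒↭ₛ xs↭ys)

  Unique-++⁻ : ∀ xs {ys : List A} → Unique (xs ++ ys) → Unique xs × Unique ys
  Unique-++⁻ []       ys!               = [] , ys!
  Unique-++⁻ (x ∷ xs) (x∉xs++ys ∷ xs++ys!) = map₁ (All.++⁻ˡ xs x∉xs++ys ∷_) (Unique-++⁻ xs xs++ys!)

  -- Trees and swap equivalence

  size≡length∘leaves : (t : Tree A) → size t ≡ length (leaves t)
  size≡length∘leaves (leaf _)   = refl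
  size≡length∘leaves (node l r) =
    trans (cong₂ _+_ (size≡length∘leaves l) (size≡length∘leaves r)) (sym (length-++ (leaves l)))

  1≤size : (t : Tree A) → 1 ≤ size t
  1≤size (leaf _)   = s≤s z≤n
  1≤size (node l r) = ≤-trans (1≤size l) (m≤m+n (size l) (size r))

  leaves↭⇒1≤length : ∀ {t S} → leaves t ↭ S → 1 ≤ length S
  leaves↭⇒1≤length {t} t↭S = subst (1 ≤_) (trans (size≡length∘leaves t) (↭-length t↭S)) (1≤size t)

  node-cong : {l l′ r r′ : Tree A} → l ≈ₜ l′ → r ≈ₜ r′ → node l r ≈ₜ node l′ r′
  node-cong {l′ = l′} {r = r} l≈l′ r≈r′ =
    gmap (λ l → node l r) (left r) l≈l′ ◅◅ gmap (node l′) (right l′) r≈r′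

  node-swap : (l r : Tree A) → node l r ≈ₜ node r l
  node-swap l r = here l r ◅ ε⋆

  leaves-resp-≈ₜ : {t u : Tree A} → t ≈ₜ u → leaves t ↭ leaves u
  leaves-resp-≈ₜ = fold (λ t u → leaves t ↭ leaves u) (λ s → ↭-trans (leaves-swap s)) ↭-refl
    where
    leaves-swap : {t u : Tree A} → SwapStep t u → leaves t ↭ leaves u
    leaves-swap (here l r)  = ++-comm (leaves l) (leaves r)
    leaves-swap (left r s)  = ++⁺ (leaves-swap s) ↭-refl
    leaves-swap (right l s) = ++⁺ˡ (leaves l) (leaves-swap s)

  node-≈ₜ-inv : {l r u : Tree A} → node l r ≈ₜ u →
                ∃₂ λ l′ r′ → u ≡ node l′ r′ × ((l ≈ₜ l′ × r ≈ₜ r′) ⊎ (l ≈ₜ r′ × r ≈ₜ l′))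
  node-≈ₜ-inv ε⋆ = _ , _ , refl , inj₁ (ε⋆ , ε⋆)
  node-≈ₜ-inv (here l r ◅ steps) with node-≈ₜ-inv steps
  ... | l′ , r′ , refl , inj₁ (r≈l′ , l≈r′) = l′ , r′ , refl , inj₂ (l≈r′ , r≈l′)
  ... | l′ , r′ , refl , inj₂ (r≈r′ , l≈l′) = l′ , r′ , refl , inj₁ (l≈l′ , r≈r′)
  node-≈ₜ-inv (left r s ◅ steps) with node-≈ₜ-inv steps
  ... | l′ , r′ , refl , inj₁ (l≈l′ , r≈r′) = l′ , r′ , refl , inj₁ (s ◅ l≈l′ , r≈r′)
  ... | l′ , r′ , refl , inj₂ (l≈r′ , r≈l′) = l′ , r′ , refl , inj₂ (s ◅ l≈r′ , r≈l′)
  node-≈ₜ-inv (right l s ◅ steps) with node-≈ₜ-inv steps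
  ... | l′ , r′ , refl , inj₁ (l≈l′ , r≈r′) = l′ , r′ , refl , inj₁ (l≈l′ , s ◅ r≈r′)
  ... | l′ , r′ , refl , inj₂ (l≈r′ , r≈l′) = l′ , r′ , refl , inj₂ (l≈r′ , s ◅ r≈l′)

  node-≈ₜ-injective : {l r l′ r′ : Tree A} → ¬ (leaves l ↭ leaves r′) →
                      node l r ≈ₜ node l′ r′ → l ≈ₜ l′ × r ≈ₜ r′
  node-≈ₜ-injective l≁r′ eq with node-≈ₜ-inv eq
  ... | _ , _ , refl , inj₁ straight      = straight
  ... | _ , _ , refl , inj₂ (l≈r′ , _)    = contradiction (leaves-resp-≈ₜ l≈r′) l≁r′

  -- Splits of a list

  IsSplit : List A → ℕ → List A × List A → Set
  IsSplit S a (L , R) = L ++ R ↭ S × length L ≡ a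

  DistinctLefts : List (List A × List A) → Set
  DistinctLefts = AllPairs (λ p q → ¬ (proj₁ p ↭ proj₁ q))

  splits : ℕ → List A → List (List A × List A)
  splits zero    S       = ([] , S) ∷ []
  splits (suc a) []      = []
  splits (suc a) (x ∷ S) = map (map₁ (x ∷_)) (splits a S) ++ map (map₂ (x ∷_)) (splits (suc a) S)

  splits-sound : ∀ a S → All (IsSplit S a) (splits a S)
  splits-sound zero    S       = (↭-refl , refl) ∷ []
  splits-sound (suc a) []      = []
  splits-sound (suc a) (x ∷ S) = All.++⁺
    (All.map⁺ (All.map (λ (L++R↭S , |L|≡a) → prep x L++R↭S , cong suc |L|≡a) (splits-sound a S)))
    (All.map⁺ (All.map (λ { {L , R} (L++R↭S , |L|≡1+a) → ↭-trans (shift x L R) (prep x L++R↭S) , |L|≡1+a })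
                       (splits-sound (suc a) S)))

  splits-complete : ∀ a S {L R} → L ++ R ↭ S → length L ≡ a →
                    Any (Pointwise _↭_ _↭_ (L , R)) (splits a S)

  splits-complete-head : ∀ a {x} S {L R} → x ∈ L → L ++ R ↭ x ∷ S → length L ≡ suc a →
                         Any (Pointwise _↭_ _↭_ (L , R)) (map (map₁ (x ∷_)) (splits a S))
  splits-complete-head a {x} S {L} {R} x∈L L++R↭x∷S |L|≡1+a with ∈⇒↭∷ x∈L
  ... | L′ , L↭x∷L′ = Any.map⁺ (Any.map (λ (L′↭ , R↭) → ↭-trans L↭x∷L′ (prep x L′↭) , R↭)
                                        (splits-complete a S L′++R↭S |L′|≡a))
    where
    L′++R↭S : L′ ++ R ↭ S
    L′++R↭S = drop-∷ (↭-trans (↭-sym (++⁺ʳ R L↭x∷L′)) L++R↭x∷S)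
    |L′|≡a : length L′ ≡ a
    |L′|≡a = suc-injective (trans (sym (↭-length L↭x∷L′)) |L|≡1+a)

  splits-complete zero    S       {[]}    L++R↭S refl = here (↭-refl , L++R↭S)
  splits-complete (suc a) []      {[]}    _       ()
  splits-complete (suc a) []      {_ ∷ _} x∷L++R↭[] _ with ↭-empty-inv x∷L++R↭[]
  ... | ()
  splits-complete (suc a) (x ∷ S) {L} {R} L++R↭x∷S |L|≡1+a
    with ∈-++⁻ L (∈-resp-↭ (↭-sym L++R↭x∷S) (here refl))
  ... | inj₁ x∈L = Any.++⁺ˡ (splits-complete-head a S x∈L L++R↭x∷S |L|≡1+a)
  ... | inj₂ x∈R with ∈⇒↭∷ x∈R
  ...   | R′ , R↭x∷R′ = Any.++⁺ʳ _ (Any.map⁺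
    (Any.map (λ (L↭ , R′↭) → L↭ , ↭-trans R↭x∷R′ (prep x R′↭)) (splits-complete (suc a) S L++R′↭S |L|≡1+a)))
    where
    L++R′↭S : L ++ R′ ↭ S
    L++R′↭S = drop-∷ (↭-trans (↭-sym (shift x L R′)) (↭-trans (++⁺ˡ L (↭-sym R↭x∷R′)) L++R↭x∷S))

  splits-distinct : ∀ a {S} → Unique S → DistinctLefts (splits a S)
  splits-distinct zero    _ = [] ∷ []
  splits-distinct (suc a) {[]} _ = []
  splits-distinct (suc a) {x ∷ S} x∷S!@(_ ∷ S!) = AllPairs.++⁺
    (AllPairs.map⁺ (AllPairs.map (λ L≁L′ → L≁L′ ∘ drop-∷) (splits-distinct a S!)))
    (AllPairs.map⁺ (splits-distinct (suc a) S!))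
    (All.map⁺ (All.tabulate λ _ → All.map⁺ (All.map x∉left (splits-sound (suc a) S))))
    where
    x∉left : ∀ {L R L′} → IsSplit S (suc a) (L , R) → ¬ (x ∷ L′ ↭ L)
    x∉left (L++R↭S , _) x∷L′↭L =
      Unique[x∷xs]⇒x∉xs x∷S! (∈-resp-↭ L++R↭S (∈-++⁺ˡ (∈-resp-↭ x∷L′↭L (here refl))))

  length-splits : ∀ a S → length (splits a S) ≡ length S C a
  length-splits zero    S       = refl
  length-splits (suc a) []      = refl
  length-splits (suc a) (x ∷ S) = begin
    length (map (map₁ (x ∷_)) (splits a S) ++ map (map₂ (x ∷_)) (splits (suc a) S))
      ≡⟨ length-++ (map (map₁ (x ∷_)) (splits a S)) ⟩
    length (map (map₁ (x ∷_)) (splits a S)) + length (map (map₂ (x ∷_)) (splits (suc a) S))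
      ≡⟨ cong₂ _+_ (length-map _ (splits a S)) (length-map _ (splits (suc a) S)) ⟩
    length (splits a S) + length (splits (suc a) S)
      ≡⟨ cong₂ _+_ (length-splits a S) (length-splits (suc a) S) ⟩
    length S C a + length S C suc a
      ≡⟨ nCk+nC[k+1]≡[n+1]C[k+1] (length S) a ⟩
    suc (length S) C suc a ∎

  -- node l r ≈ₜ node l′ r′ forces l ≈ₜ l′ or l ≈ₜ r′, which these conditions on the leaf
  -- lists exclude for trees built over the splits in ps.
  Separating : List (List A × List A) → Set
  Separating ps = All (λ (L , R) → ¬ (L ↭ R)) ps ×
                  AllPairs (λ (L , R) (L′ , R′) → ¬ (L ↭ L′) × ¬ (L ↭ R′)) ps

  tagged⇒separating : (P : List A → Set) → P Respects _↭_ → {ps : List (List A × List A)} →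
                      All (λ (L , R) → P L × ¬ P R) ps → DistinctLefts ps → Separating ps
  tagged⇒separating P resp tags distinct =
    All.map (λ (PL , ¬PR) L↭R → ¬PR (resp L↭R PL)) tags ,
    AllPairs-mapWith tags (λ (PL , _) (_ , ¬PR′) L≁L′ → L≁L′ , λ L↭R′ → ¬PR′ (resp L↭R′ PL)) distinct

  IsHalving : List A → List A × List A → Set
  IsHalving S (L , R) = L ++ R ↭ S × length L ≡ ⌊ length S /2⌋ × length R ≡ ⌈ length S /2⌉

  isSplit⇒isHalving : ∀ {S L R} → IsSplit S ⌊ length S /2⌋ (L , R) → IsHalving S (L , R)
  isSplit⇒isHalving {S} {L} {R} (L++R↭S , |L|≡a) = L++R↭S , |L|≡a , (begin
    length R                       ≡⟨ m+n∸m≡n (length L) (length R) ⟨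
    length L + length R ∸ length L ≡⟨ cong₂ _∸_ (trans (sym (length-++ L)) (↭-length L++R↭S)) |L|≡a ⟩
    length S ∸ ⌊ length S /2⌋      ≡⟨ ⌈n/2⌉≡n∸⌊n/2⌋ (length S) ⟨
    ⌈ length S /2⌉                 ∎)

  -- With an even number of leaves both halves have the same size; the head x is then
  -- forced into the left half, so that each unordered split is listed once.
  halvingSplits : A → (S : List A) → Parity (length S) → List (List A × List A)
  halvingSplits x S (even p _) = splits p (x ∷ S)
  halvingSplits x S (odd  p _) = map (map₁ (x ∷_)) (splits p S)

  halvingSplits-sound : ∀ x S π → All (IsHalving (x ∷ S)) (halvingSplits x S π)
  halvingSplits-sound x S (even p |S|≡p*2) =
    All.map (λ { {L , R} (L++R↭ , |L|≡p) →
                 isSplit⇒isHalving {L = L} {R} (L++R↭ , trans |L|≡p (sym (proj₁ (halves[1+p*2] p |S|≡p*2)))) })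
            (splits-sound p (x ∷ S))
  halvingSplits-sound x S (odd p |S|≡1+p*2) = All.map⁺
    (All.map (λ { {L , R} (L++R↭S , |L|≡p) →
                  isSplit⇒isHalving {L = x ∷ L} {R}
                    (prep x L++R↭S , trans (cong suc |L|≡p) (sym (proj₁ (halves[2+p*2] p |S|≡1+p*2)))) })
             (splits-sound p S))

  halvingSplits-count : ∀ x S π →
    length (halvingSplits x S π) * 2 ^ evenIndicator (suc (length S)) ≡ suc (length S) C ⌊ suc (length S) /2⌋
  halvingSplits-count x S (even p |S|≡p*2) = begin
    length (splits p (x ∷ S)) * 2 ^ evenIndicator (suc (length S))
      ≡⟨ cong₂ (λ c e → c * 2 ^ e) (length-splits p (x ∷ S))
               (trans (cong (evenIndicator ∘ suc) |S|≡p*2) (evenIndicator[1+n*2]≡0 p)) ⟩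
    (suc (length S) C p) * 1                 ≡⟨ *-identityʳ _ ⟩
    suc (length S) C p                       ≡⟨ cong (suc (length S) C_) (proj₁ (halves[1+p*2] p |S|≡p*2)) ⟨
    suc (length S) C ⌊ suc (length S) /2⌋    ∎
  halvingSplits-count x S (odd p |S|≡1+p*2) = begin
    length (map (map₁ (x ∷_)) (splits p S)) * 2 ^ evenIndicator (suc (length S))
      ≡⟨ cong₂ (λ c e → c * 2 ^ e) (trans (length-map _ (splits p S)) (length-splits p S))
               (trans (cong (evenIndicator ∘ suc) |S|≡1+p*2) (evenIndicator[n*2]≡1 (suc p))) ⟩
    (length S C p) * 2                       ≡⟨ cong (λ m → (m C p) * 2) |S|≡1+p*2 ⟩
    (suc (p * 2) C p) * 2                    ≡⟨ [1+n*2]Cn*2≡[2+n*2]C[1+n] p ⟩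
    suc (suc (p * 2)) C suc p
      ≡⟨ cong₂ _C_ (cong suc |S|≡1+p*2) (proj₁ (halves[2+p*2] p |S|≡1+p*2)) ⟨
    suc (length S) C ⌊ suc (length S) /2⌋    ∎

  halvingSplits-separating : ∀ x S π → Unique (x ∷ S) → Separating (halvingSplits x S π)
  halvingSplits-separating x S π@(even p |S|≡p*2) x∷S! =
    tagged⇒separating (λ L → length L ≡ p) (λ L↭L′ |L|≡p → trans (sym (↭-length L↭L′)) |L|≡p)
      (All.map (λ { {L , R} (_ , |L|≡a , |R|≡b) →
                    trans |L|≡a a≡p , λ |R|≡p → 1+n≢n (trans (sym b≡1+p) (trans (sym |R|≡b) |R|≡p)) })
               (halvingSplits-sound x S π))
      (splits-distinct p x∷S!)
    where
    a≡p = proj₁ (halves[1+p*2] p |S|≡p*2)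
    b≡1+p = proj₂ (halves[1+p*2] p |S|≡p*2)
  halvingSplits-separating x S (odd p _) x∷S!@(_ ∷ S!) =
    tagged⇒separating (x ∈_) (λ L↭L′ x∈L → ∈-resp-↭ L↭L′ x∈L)
      (All.map⁺ (All.map (λ { {L , R} (L++R↭S , _) → here refl ,
                               λ x∈R → Unique[x∷xs]⇒x∉xs x∷S! (∈-resp-↭ L++R↭S (∈-++⁺ʳ L x∈R)) })
                         (splits-sound p S)))
      (AllPairs.map⁺ (AllPairs.map (λ L≁L′ → L≁L′ ∘ drop-∷) (splits-distinct p S!)))

  halvingSplits-complete : ∀ x S π {L R} → L ++ R ↭ x ∷ S → Balanced (length L) (length R) →
    Any (λ p → Pointwise _↭_ _↭_ (L , R) p ⊎ Pointwise _↭_ _↭_ (R , L) p) (halvingSplits x S π)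
  halvingSplits-complete x S (even p |S|≡p*2) {L} {R} L++R↭ balanced =
    [ (λ (|L|≡a , _) → Any.map inj₁ (splits-complete p (x ∷ S) L++R↭ (trans |L|≡a a≡p)))
    , (λ (_ , |R|≡a) → Any.map inj₂ (splits-complete p (x ∷ S) R++L↭ (trans |R|≡a a≡p)))
    ]′
    (Balanced⇒halves (trans (sym (length-++ L)) (↭-length L++R↭)) balanced)
    where
    a≡p = proj₁ (halves[1+p*2] p |S|≡p*2)
    R++L↭ = ↭-trans (++-comm R L) L++R↭
  halvingSplits-complete x S (odd p |S|≡1+p*2) {L} {R} L++R↭ balanced =
    [ (λ x∈L → Any.map inj₁ (splits-complete-head p S x∈L L++R↭ |L|≡1+p))
    , (λ x∈R → Any.map inj₂ (splits-complete-head p S x∈R (↭-trans (++-comm R L) L++R↭) |R|≡1+p))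
    ]′
    (∈-++⁻ L (∈-resp-↭ (↭-sym L++R↭) (here refl)))
    where
    halves≡1+p = halves[2+p*2] p |S|≡1+p*2
    |L|≡1+p×|R|≡1+p : length L ≡ suc p × length R ≡ suc p
    |L|≡1+p×|R|≡1+p with Balanced⇒halves (trans (sym (length-++ L)) (↭-length L++R↭)) balanced
    ... | inj₁ (|L|≡a , |R|≡b) = trans |L|≡a (proj₁ halves≡1+p) , trans |R|≡b (proj₂ halves≡1+p)
    ... | inj₂ (|L|≡b , |R|≡a) = trans |L|≡b (proj₂ halves≡1+p) , trans |R|≡a (proj₁ halves≡1+p)
    |L|≡1+p = proj₁ |L|≡1+p×|R|≡1+p
    |R|≡1+p = proj₂ |L|≡1+p×|R|≡1+p

  -- One pairwise summation from each class

  All-nodes⁺ : {P : Tree A → Set} (ls rs : List (Tree A)) →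
               (∀ {l r} → l ∈ ls → r ∈ rs → P (node l r)) → All P (cartesianProductWith node ls rs)
  All-nodes⁺ = All.cartesianProductWith⁺ (setoid (Tree A)) (setoid (Tree A)) node

  Inequivalent : List (Tree A) → Set
  Inequivalent = AllPairs (λ t u → ¬ (t ≈ₜ u))

  cartesianProductWith-node-inequivalent : {ls rs : List (Tree A)} →
    (∀ {l r} → l ∈ ls → r ∈ rs → ¬ (leaves l ↭ leaves r)) →
    Inequivalent ls → Inequivalent rs → Inequivalent (cartesianProductWith node ls rs)
  cartesianProductWith-node-inequivalent {[]}     _   []           _   = []
  cartesianProductWith-node-inequivalent {l ∷ ls} {rs} apart (l≉ls ∷ ls!) rs! = AllPairs.++⁺
    (AllPairs.map⁺ (AllPairs-mapWith (All.tabulate (apart (here refl)))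
                                     (λ _ l≁r′ r≉r′ → r≉r′ ∘ proj₂ ∘ node-≈ₜ-injective l≁r′) rs!))
    (cartesianProductWith-node-inequivalent (apart ∘ there) ls! rs!)
    (All.map⁺ (All.tabulate λ _ → All-nodes⁺ ls rs λ l′∈ls r′∈rs →
      All.lookup l≉ls l′∈ls ∘ proj₁ ∘ node-≈ₜ-injective (apart (here refl) r′∈rs)))

  WellLabelled : (List A → List (Tree A)) → Set
  WellLabelled g = ∀ L → All (λ t → leaves t ↭ L) (g L)

  nodesOver : (List A → List (Tree A)) → List A × List A → List (Tree A)
  nodesOver g (L , R) = cartesianProductWith node (g L) (g R)

  nodesOver-inequivalent : ∀ {g} → WellLabelled g → ∀ {L R} → ¬ (L ↭ R) →
                           Inequivalent (g L) → Inequivalent (g R) → Inequivalent (nodesOver g (L , R))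
  nodesOver-inequivalent labelled {L} {R} L≁R = cartesianProductWith-node-inequivalent λ l∈ r∈ →
    L≁R ∘ ↭-transport (All.lookup (labelled L) l∈) (All.lookup (labelled R) r∈)

  nodesOver-apart : ∀ {g} → WellLabelled g → ∀ {L R L′ R′} → ¬ (L ↭ L′) → ¬ (L ↭ R′) →
                    All (λ t → All (λ u → ¬ (t ≈ₜ u)) (nodesOver g (L′ , R′))) (nodesOver g (L , R))
  nodesOver-apart {g} labelled {L} {R} {L′} {R′} L≁L′ L≁R′ =
    All-nodes⁺ (g L) (g R) λ l∈ _ → All-nodes⁺ (g L′) (g R′) λ l′∈ r′∈ →
      let l↭L = All.lookup (labelled L) l∈
      in L≁L′ ∘ ↭-transport l↭L (All.lookup (labelled L′) l′∈) ∘ leaves-resp-≈ₜ ∘ proj₁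
              ∘ node-≈ₜ-injective (L≁R′ ∘ ↭-transport l↭L (All.lookup (labelled R′) r′∈))

  concatMap-nodesOver-inequivalent : ∀ {g} → WellLabelled g → {ps : List (List A × List A)} → Separating ps →
    All (λ (L , R) → Inequivalent (g L) × Inequivalent (g R)) ps → Inequivalent (concatMap (nodesOver g) ps)
  concatMap-nodesOver-inequivalent labelled (L≁R , distinct) g! = AllPairs.concat⁺
    (All.map⁺ (All.zipWith (λ (L≁R , gL! , gR!) → nodesOver-inequivalent labelled L≁R gL! gR!) (L≁R , g!)))
    (AllPairs.map⁺ (AllPairs.map (λ (L≁L′ , L≁R′) → nodesOver-apart labelled L≁L′ L≁R′) distinct))

  pairwiseTrees : ℕ → List A → List (Tree A)
  pairwiseTrees zero    _               = []
  pairwiseTrees (suc f) []              = []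
  pairwiseTrees (suc f) (x ∷ [])        = leaf x ∷ []
  pairwiseTrees (suc f) (x ∷ S@(_ ∷ _)) =
    concatMap (nodesOver (pairwiseTrees f)) (halvingSplits x S (parity (length S)))

  pairwiseTrees-sound : ∀ f S → All (λ t → leaves t ↭ S × IsPairwise t) (pairwiseTrees f S)
  pairwiseTrees-sound zero    _               = []
  pairwiseTrees-sound (suc f) []              = []
  pairwiseTrees-sound (suc f) (x ∷ [])        = (↭-refl , _) ∷ []
  pairwiseTrees-sound (suc f) (x ∷ S@(_ ∷ _)) =
    All.concat⁺ (All.map⁺ (All.map sound-nodes (halvingSplits-sound x S (parity (length S)))))
    where
    sound-nodes : ∀ {p} → IsHalving (x ∷ S) p →
                  All (λ t → leaves t ↭ x ∷ S × IsPairwise t) (nodesOver (pairwiseTrees f) p)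
    sound-nodes {L , R} (L++R↭ , |L|≡a , |R|≡b) =
      All-nodes⁺ (pairwiseTrees f L) (pairwiseTrees f R) λ {l} {r} l∈ r∈ →
      let l↭L , pl = All.lookup (pairwiseTrees-sound f L) l∈
          r↭R , pr = All.lookup (pairwiseTrees-sound f R) r∈
      in ↭-trans (++⁺ l↭L r↭R) L++R↭ , pl , pr ,
         subst₂ Balanced (sym (trans (size≡length∘leaves l) (trans (↭-length l↭L) |L|≡a)))
                         (sym (trans (size≡length∘leaves r) (trans (↭-length r↭R) |R|≡b)))
                         (balanced-halves (length (x ∷ S)))

  pairwiseTrees-inequivalent : ∀ f S → Unique S → Inequivalent (pairwiseTrees f S)
  pairwiseTrees-inequivalent zero    _               _     = []
  pairwiseTrees-inequivalent (suc f) []              _     = []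
  pairwiseTrees-inequivalent (suc f) (x ∷ [])        _     = [] ∷ []
  pairwiseTrees-inequivalent (suc f) (x ∷ S@(_ ∷ _)) x∷S! =
    concatMap-nodesOver-inequivalent (λ L → All.map proj₁ (pairwiseTrees-sound f L))
      (halvingSplits-separating x S (parity (length S)) x∷S!)
      (All.map (λ { {L , R} (L++R↭ , _) →
                    let L! , R! = Unique-++⁻ L (Unique-resp-↭ (↭-sym L++R↭) x∷S!)
                    in pairwiseTrees-inequivalent f L L! , pairwiseTrees-inequivalent f R R! })
               (halvingSplits-sound x S (parity (length S))))

  pairwiseTrees-complete : ∀ f S {t} → length S ≤ f → IsPairwise t → leaves t ↭ S →
                           Any (t ≈ₜ_) (pairwiseTrees f S)
  pairwiseTrees-complete zero    S  {t} |S|≤0 _ t↭S  =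
    contradiction (≤-trans (leaves↭⇒1≤length {t} t↭S) |S|≤0) λ ()
  pairwiseTrees-complete (suc f) [] {t} _     _ t↭[] =
    contradiction (leaves↭⇒1≤length {t} t↭[]) λ ()
  pairwiseTrees-complete (suc f) (x ∷ []) {leaf y} _ _ y↭x with ↭-singleton-inv y↭x
  ... | refl = here ε⋆
  pairwiseTrees-complete (suc f) (x ∷ []) {node l r} _ _ lr↭x =
    contradiction (trans (size≡length∘leaves (node l r)) (↭-length lr↭x))
                  (>⇒≢ (+-mono-≤ (1≤size l) (1≤size r)))
  pairwiseTrees-complete (suc f) (x ∷ _ ∷ _) {leaf y} _ _ y↭ with ↭-length y↭
  ... | ()
  pairwiseTrees-complete (suc f) (x ∷ S@(_ ∷ _)) {node l r} (s≤s |S|≤f) (pl , pr , balanced) lr↭ =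
    Any.concatMap⁺ (nodesOver (pairwiseTrees f)) (Any.map matching (halvingSplits-complete x S (parity (length S)) lr↭
      (subst₂ Balanced (size≡length∘leaves l) (size≡length∘leaves r) balanced)))
    where
    size≡ : size (node l r) ≡ suc (length S)
    size≡ = trans (size≡length∘leaves (node l r)) (↭-length lr↭)
    subtree : ∀ {u M} → size u < size (node l r) → IsPairwise u → leaves u ↭ M →
              Any (u ≈ₜ_) (pairwiseTrees f M)
    subtree {u} u<lr pu u↭M = pairwiseTrees-complete f _
      (subst (_≤ f) (trans (size≡length∘leaves u) (↭-length u↭M))
                    (≤-trans (≤-pred (subst (size u <_) size≡ u<lr)) |S|≤f))
      pu u↭M
    l< = m<m+n (size l) (1≤size r)
    r< = m<n+m (size r) (1≤size l)
    matching : ∀ {p} → Pointwise _↭_ _↭_ (leaves l , leaves r) p ⊎ Pointwise _↭_ _↭_ (leaves r , leaves l) p →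
               Any (node l r ≈ₜ_) (nodesOver (pairwiseTrees f) p)
    matching (inj₁ (l↭L , r↭R)) =
      Any.cartesianProductWith⁺ node node-cong (subtree l< pl l↭L) (subtree r< pr r↭R)
    matching (inj₂ (r↭L , l↭R)) = Any.map (node-swap l r ◅◅_)
      (Any.cartesianProductWith⁺ node node-cong (subtree r< pr r↭L) (subtree l< pl l↭R))

  length-concatMap-nodesOver : ∀ g {a b x y c d} {ps : List (List A × List A)} →
    (∀ {M} → length M ≡ a → length (g M) * x ≡ c) → (∀ {M} → length M ≡ b → length (g M) * y ≡ d) →
    All (λ (L , R) → length L ≡ a × length R ≡ b) ps →
    length (concatMap (nodesOver g) ps) * (x * y) ≡ length ps * (c * d)
  length-concatMap-nodesOver g {x = x} {y = y} count-a count-b sizes =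
    length-concatMap-uniform (nodesOver g) (All.map (λ { {L , R} (|L|≡a , |R|≡b) → begin
      length (cartesianProductWith node (g L) (g R)) * (x * y)
        ≡⟨ cong (_* (x * y)) (length-cartesianProductWith node (g L) (g R)) ⟩
      length (g L) * length (g R) * (x * y)  ≡⟨ interchange (length (g L)) (length (g R)) x y ⟩
      length (g L) * x * (length (g R) * y)  ≡⟨ cong₂ _*_ (count-a |L|≡a) (count-b |R|≡b) ⟩
      _ ∎ }) sizes)
    where
    interchange : ∀ m n x y → m * n * (x * y) ≡ m * x * (n * y)
    interchange = solve-∀

  pairwiseTrees-count : ∀ f S → 1 ≤ length S → length S ≤ f →
                        length (pairwiseTrees f S) * 2 ^ evenNodes (length S) ≡ length S !
  pairwiseTrees-count zero    (_ ∷ _)          _ ()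
  pairwiseTrees-count (suc f) (x ∷ [])         _ _ = refl
  pairwiseTrees-count (suc f) (x ∷ S@(_ ∷ S′)) _ (s≤s |S|≤f) = begin
    N * 2 ^ evenNodes k                ≡⟨ cong (N *_) (2^evenNodes-unfold (length S′)) ⟩
    N * (2 ^ δ * (2 ^ Ea * 2 ^ Eb))    ≡⟨ rotate N (2 ^ δ) (2 ^ Ea * 2 ^ Eb) ⟩
    N * (2 ^ Ea * 2 ^ Eb) * 2 ^ δ
      ≡⟨ cong (_* 2 ^ δ) (length-concatMap-nodesOver (pairwiseTrees f)
           (λ |M|≡a → count-half |M|≡a (s≤s z≤n) (≤-trans (⌊[2+n]/2⌋≤1+n (length S′)) |S|≤f))
           (λ |M|≡b → count-half |M|≡b (s≤s z≤n) (≤-trans (⌈[2+n]/2⌉≤1+n (length S′)) |S|≤f))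
           (All.map (λ (_ , |L|≡a , |R|≡b) → |L|≡a , |R|≡b) (halvingSplits-sound x S π))) ⟩
    length ps * (a ! * b !) * 2 ^ δ    ≡⟨ swap (length ps) (a ! * b !) (2 ^ δ) ⟩
    length ps * 2 ^ δ * (a ! * b !)    ≡⟨ cong (_* (a ! * b !)) (halvingSplits-count x S π) ⟩
    (k C a) * (a ! * b !)              ≡⟨ cong (λ h → (k C a) * (a ! * h !)) (⌈n/2⌉≡n∸⌊n/2⌋ k) ⟩
    (k C a) * (a ! * (k ∸ a) !)        ≡⟨ nCk*[k!*[n∸k]!]≡n! (⌊n/2⌋≤n k) ⟩
    k !                                ∎
    where
    π = parity (length S)
    ps = halvingSplits x S π
    N = length (concatMap (nodesOver (pairwiseTrees f)) ps)
    k = suc (length S)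
    a = ⌊ k /2⌋
    b = ⌈ k /2⌉
    δ = evenIndicator k
    Ea = evenNodes a
    Eb = evenNodes b
    rotate : ∀ n c d → n * (c * d) ≡ n * d * c
    rotate = solve-∀
    swap : ∀ n c d → n * c * d ≡ n * d * c
    swap = solve-∀
    count-half : ∀ {M h} → length M ≡ h → 1 ≤ h → h ≤ f →
                 length (pairwiseTrees f M) * 2 ^ evenNodes h ≡ h !
    count-half {M} refl = pairwiseTrees-count f M

corollary15 : (n : ℕ) → 1 ≤ n →
    ∃[ xs ] (IsClassRepresentatives n xs × IsNFactOver2^ (length xs) (n !) (ε n))
corollary15 n 1≤n = All.toList sound , (inequivalent , complete) , count
  where
  trees = pairwiseTrees n (allFin n)
  sound : All (λ t → IsSummation n t × IsPairwise t) trees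
  sound = pairwiseTrees-sound n (allFin n)
  toList≡trees : map proj₁ (All.toList sound) ≡ trees
  toList≡trees = map-proj₁-toList sound
  |allFin|≡n : length (allFin n) ≡ n
  |allFin|≡n = length-tabulate (λ i → i)
  inequivalent = AllPairs.map⁻ (subst Inequivalent (sym toList≡trees)
    (pairwiseTrees-inequivalent n (allFin n) (allFin⁺ n)))
  complete : (s : PairwiseSummation n) → Any (λ a → proj₁ s ≈ₜ proj₁ a) (All.toList sound)
  complete (t , summation , pairwise) = Any.map⁻ (subst (Any (t ≈ₜ_)) (sym toList≡trees)
    (pairwiseTrees-complete n (allFin n) (≤-reflexive |allFin|≡n) pairwise summation))
  count = subst (IsNFactOver2^ (length (All.toList sound)) (n !)) (sym (ε≡+evenNodes n 1≤n)) (begin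
    length (All.toList sound) * 2 ^ evenNodes n
      ≡⟨ cong (_* 2 ^ evenNodes n)
              (trans (sym (length-map proj₁ (All.toList sound))) (cong length toList≡trees)) ⟩
    length trees * 2 ^ evenNodes n
      ≡⟨ subst (λ m → length trees * 2 ^ evenNodes m ≡ m !) |allFin|≡n
               (pairwiseTrees-count n (allFin n) (subst (1 ≤_) (sym |allFin|≡n) 1≤n)
                                                  (≤-reflexive |allFin|≡n)) ⟩
    n ! ∎)
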